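{- Let $\Gamma$ be a distance-biregular graph on $n$ vertices with stable sets $V_0,V_1$ and equilibrium arrays $q_{\ell,i}$. Let $y\in V_\ell$ and $x\in V_{\hat\ell}$, $\ell,\hat\ell\in\{0,1\}$. Then the effective resistance between $x$ and $y$ is $$R(x,y)=\frac{2}{n}\,q_{\ell,d(x,y)}+\frac{n-1}{n}\left(\frac1{k_{\hat\ell}}-\frac1{k_\ell}\right).$$
   Context: Graphs are finite, connected, simple (every edge has unit conductance), $n=|V|\ge2$, $d$ the graph distance, $\Gamma_i(x)=\{y:d(x,y)=i\}$. Laplacian: $\mathcal L(u)(x)=\sum_{y\sim x}(u(x)-u(y))$, with matrix $\mathsf L$ and group inverse $\mathsf L^\#$. The effective resistance is $R(x,y)=\mathsf L^\#(x,x)+\mathsf L^\#(y,y)-2\mathsf L^\#(x,y)$. For $y\in V$, $\nu^y$ is the unique function with $\nu^y(y)=0$, $\nu^y(x)>0$ for $x\neq y$ and $\mathcal L(\nu^y)=\mathbf 1-n\varepsilon_y$. A distance-biregular graph is a connected bipartite graph with stable sets $V_0,V_1$, every vertex in $V_\ell$ of degree $k_\ell$, such that for vertices $x,y$ at distance $i$ the numbers $|\Gamma_{i-1}(x)\cap\Gamma_1(y)|$, $|\Gamma_{i+1}(x)\cap\Gamma_1(y)|$ depend only on $i$ and the stable set of $x$. $D_\ell=\max\{d(x,y):x\in V_\ell,y\in V\}$. The equilibrium arrays are the numbers $q_{\ell,m}$ ($m=0,\dots,D_\ell$) such that for $x\in V_\ell$, $\nu^x(y)=q_{\ell,m}$ iff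 $d(x,y)=m$. -}

module Defs where

open import Data.Nat as ℕ using (ℕ; zero; suc; _∸_)
open import Data.Fin using (Fin; zero; suc)
import Data.Fin as F
open import Data.Bool using (Bool; true; false; _∧_; _∨_; if_then_else_)
open import Data.Rational using (ℚ; 0ℚ; 1ℚ; _+_; _*_; _-_; -_; _/_; _<_)
open import Data.Integer using (+_)
open import Data.Product using (Σ; ∃; _×_)
open import Relation.Nullary using (¬_)
open import Relation.Nullary.Decidable using (⌊_⌋)
open import Relation.Binary.PropositionalEquality using (_≡_; _≢_)

-- A finite simple graph on vertex set Fin n (unit conductances).
record Graph (n : ℕ) : Set where
  field
    adj    : Fin n → Fin n → Bool
    adj-sym : ∀ x y → adj x y ≡ adj y x
    irrefl : ∀ x → adj x x ≡ false

anyFin : ∀ {n} → (Fin n → Bool) → Bool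
anyFin {zero}  f = false
anyFin {suc n} f = f zero ∨ anyFin (λ i → f (suc i))

countFin : ∀ {n} → (Fin n → Bool) → ℕ
countFin {zero}  f = 0
countFin {suc n} f = (if f zero then 1 else 0) ℕ.+ countFin (λ i → f (suc i))

sumℚ : ∀ {n} → (Fin n → ℚ) → ℚ
sumℚ {zero}  f = 0ℚ
sumℚ {suc n} f = f zero + sumℚ (λ i → f (suc i))

ℕ→ℚ : ℕ → ℚ
ℕ→ℚ m = + m / 1

-- 1/m for m ≥ 1 (value at 0 is an irrelevant junk value 0)
recipℕ : ℕ → ℚ
recipℕ zero    = 0ℚ
recipℕ (suc m) = + 1 / suc m

Matrix : ℕ → Set
Matrix n = Fin n → Fin n → ℚ

_·_ : ∀ {n} → Matrix n → Matrix n → Matrix n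
(A · B) i j = sumℚ (λ k → A i k * B k j)

IsGroupInverse : ∀ {n} → Matrix n → Matrix n → Set
IsGroupInverse A G = (∀ i j → ((A · G) · A) i j ≡ A i j)
                   × (∀ i j → ((G · A) · G) i j ≡ G i j)
                   × (∀ i j → (A · G) i j ≡ (G · A) i j)

module _ {n : ℕ} (Γ : Graph n) where
  open Graph Γ

  degree : Fin n → ℕ
  degree x = countFin (adj x)

  reach : ℕ → Fin n → Fin n → Bool
  reach zero    x y = ⌊ x F.≟ y ⌋
  reach (suc k) x y = reach k x y ∨ anyFin (λ z → adj x z ∧ reach k z y)

  Connected : Set
  Connected = ∀ x y → ∃ λ k → reach k x y ≡ true

  -- graph distance: least k with reach k x y (search with fuel n; for a
  -- connected graph the distance is ≤ n - 1, so the search never runs out)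
  distSearch : Fin n → Fin n → ℕ → ℕ → ℕ
  distSearch x y zero     k = k
  distSearch x y (suc f) k = if reach k x y then k else distSearch x y f (suc k)

  dist : Fin n → Fin n → ℕ
  dist x y = distSearch x y n 0

  lap : (Fin n → ℚ) → Fin n → ℚ
  lap u x = sumℚ (λ y → if adj x y then u x - u y else 0ℚ)

  Lmat : Matrix n
  Lmat x y = if ⌊ x F.≟ y ⌋ then ℕ→ℚ (degree x)
             else (if adj x y then - 1ℚ else 0ℚ)

  effRes : Matrix n → Fin n → Fin n → ℚ
  effRes Ls x y = Ls x x + Ls y y - ℕ→ℚ 2 * Ls x y

  IsEquilibrium : (Fin n → ℚ) → Fin n → Set
  IsEquilibrium ν y = (ν y ≡ 0ℚ)
                    × (∀ x → x ≢ y → 0ℚ < ν x)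
                    × (∀ x → lap ν x ≡ 1ℚ - (if ⌊ x F.≟ y ⌋ then ℕ→ℚ n else 0ℚ))

  -- distance-biregular structure: a bipartition side (V_0 = side⁻¹ 0,
  -- V_1 = side⁻¹ 1) into stable sets, degrees k_ℓ, and intersection numbers
  -- c_ℓ(i) = |Γ_{i-1}(x) ∩ Γ_1(y)|, b_ℓ(i) = |Γ_{i+1}(x) ∩ Γ_1(y)|
  -- depending only on i = d(x,y) and the stable set ℓ of x.
  record DistanceBiregular : Set where
    field
      side   : Fin n → Fin 2
      stable : ∀ x y → adj x y ≡ true → side x ≢ side y
      k      : Fin 2 → ℕ
      deg-k  : ∀ x → degree x ≡ k (side x)
      c      : Fin 2 → ℕ → ℕ
      b      : Fin 2 → ℕ → ℕ
      c-prop : ∀ x y → countFin (λ z → adj y z ∧ ⌊ dist x z ℕ.≟ dist x y ∸ 1 ⌋)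
                         ≡ c (side x) (dist x y)
      b-prop : ∀ x y → countFin (λ z → adj y z ∧ ⌊ dist x z ℕ.≟ suc (dist x y) ⌋)
                         ≡ b (side x) (dist x y)

-- Write r = 1/n and s x = Σ_z ν^x(z).  The equilibrium equations say L N = J − nI, where N has
-- the functions ν^y as columns.  As L and its group inverse G have zero row sums, this forces
-- G L = I − J/n and then G(i,j) = r²(s j − n ν^j(i)), so that R(x,y) = 2r ν^y(x) + r²(s x − s y).
-- Symmetry of L gives the reciprocity s x − n ν^x(y) = s y − n ν^y(x).  In a distance-biregular
-- graph ν^x is constant on the neighbours of x, whence ν^x(y) = (n − 1)/k x for y ~ x; so
-- s x − n(n − 1)/k x is invariant along edges, hence constant, and s x − s y = n(n − 1)(1/k x − 1/k y).
module Submission where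

open import Defs
open import Data.Nat using (ℕ; _≤_; _∸_)
open import Data.Fin using (Fin)
open import Data.Rational using (ℚ; _+_; _*_; _-_)
open import Relation.Binary.PropositionalEquality using (_≡_)

open import Algebra.Bundles using (CommutativeRing)
open import Data.Bool using (Bool; true; false; _∧_; _∨_; if_then_else_)
open import Data.Bool.Properties using (∨-zeroʳ; ⇔→≡)
import Data.Fin as Fin
open import Data.Fin using (zero; suc)
open import Data.Fin.Properties using (suc-injective)
import Data.Integer as ℤ
import Data.Integer.Properties as ℤ
open import Data.Nat as ℕ using (zero; suc; NonZero; z≤n; s≤s)
import Data.Nat.Properties as ℕ
open import Data.Nat.Coprimality using (1-coprimeTo) renaming (sym to coprime-sym)
open import Data.Product using (∃-syntax; _×_; _,_; proj₁; proj₂)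
open import Data.Rational using (0ℚ; 1ℚ; -_; mkℚ)
open import Data.Rational.Properties
  using ( normalize-coprime; *-inverseˡ; *-identityˡ; *-identityʳ; *-zeroˡ; *-zeroʳ; *-comm
        ; +-identityˡ; +-identityʳ; +-0-group; +-*-commutativeRing)
open import Data.Rational.Solver using (module +-*-Solver)
open import Data.Sum using (_⊎_; inj₁; inj₂)
open import Function using (_∘_; mk⇔)
open import Relation.Nullary using (yes; no; contradiction)
open import Relation.Nullary.Decidable using (⌊_⌋; isYes≗does; dec-true; dec-false; does-⇔)
open import Relation.Binary.PropositionalEquality using (refl; sym; trans; cong; cong₂; _≢_; module ≡-Reasoning)

open import Algebra.Properties.Semiring.Sum (CommutativeRing.semiring +-*-commutativeRing)
  using (sum; sum-cong-≗; sum-replicate-zero; ∑-distrib-+; ∑-comm; *-distribˡ-sum)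
open import Algebra.Properties.Group +-0-group using () renaming (⁻¹-involutive to neg-involutive)
open ≡-Reasoning
open +-*-Solver

-- Natural numbers in ℚ

ℕ→ℚ≡mkℚ : ∀ m → ℕ→ℚ m ≡ mkℚ (ℤ.+ m) 0 (coprime-sym (1-coprimeTo m))
ℕ→ℚ≡mkℚ m = normalize-coprime (coprime-sym (1-coprimeTo m))

ℕ→ℚ-suc : ∀ m → ℕ→ℚ (suc m) ≡ 1ℚ + ℕ→ℚ m
ℕ→ℚ-suc m rewrite ℕ→ℚ≡mkℚ m | ℤ.*-identityʳ (ℤ.+ m) = refl

ℕ→ℚ-∸1 : ∀ n .{{_ : NonZero n}} → ℕ→ℚ n - 1ℚ ≡ ℕ→ℚ (n ∸ 1)
ℕ→ℚ-∸1 (suc m) = begin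
  ℕ→ℚ (suc m) - 1ℚ    ≡⟨ cong (_- 1ℚ) (ℕ→ℚ-suc m) ⟩
  1ℚ + ℕ→ℚ m - 1ℚ     ≡⟨ solve 1 (λ p → con 1ℚ :+ p :- con 1ℚ := p) refl (ℕ→ℚ m) ⟩
  ℕ→ℚ m               ∎

recipℕ-inverseˡ : ∀ n .{{_ : NonZero n}} → recipℕ n * ℕ→ℚ n ≡ 1ℚ
recipℕ-inverseˡ (suc m)
  rewrite ℕ→ℚ≡mkℚ (suc m) | normalize-coprime {1} {m} (1-coprimeTo (suc m)) =
  *-inverseˡ (mkℚ (ℤ.+ suc m) 0 (coprime-sym (1-coprimeTo (suc m))))

recipℕ*ℕ→ℚ*-cancel : ∀ n .{{_ : NonZero n}} a → recipℕ n * (ℕ→ℚ n * a) ≡ a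
recipℕ*ℕ→ℚ*-cancel n a = begin
  recipℕ n * (ℕ→ℚ n * a)  ≡⟨ solve 3 (λ r m a → r :* (m :* a) := (r :* m) :* a) refl (recipℕ n) (ℕ→ℚ n) a ⟩
  recipℕ n * ℕ→ℚ n * a    ≡⟨ cong (_* a) (recipℕ-inverseˡ n) ⟩
  1ℚ * a                  ≡⟨ *-identityˡ a ⟩
  a                       ∎

ℕ→ℚ*a≡b⇒a≡recipℕ*b : ∀ d .{{_ : NonZero d}} {a b} → ℕ→ℚ d * a ≡ b → a ≡ recipℕ d * b
ℕ→ℚ*a≡b⇒a≡recipℕ*b d {a} da≡b = trans (sym (recipℕ*ℕ→ℚ*-cancel d a)) (cong (recipℕ d *_) da≡b)

⌊≟⌋-refl : ∀ {n} (j : Fin n) → ⌊ j Fin.≟ j ⌋ ≡ true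
⌊≟⌋-refl j = trans (isYes≗does (j Fin.≟ j)) (dec-true (j Fin.≟ j) refl)

⌊≟⌋-≢ : ∀ {n} {j k : Fin n} → j ≢ k → ⌊ j Fin.≟ k ⌋ ≡ false
⌊≟⌋-≢ {j = j} {k} j≢k = trans (isYes≗does (j Fin.≟ k)) (dec-false (j Fin.≟ k) j≢k)

⌊≟⌋⇒≡ : ∀ {n} {j k : Fin n} → ⌊ j Fin.≟ k ⌋ ≡ true → j ≡ k
⌊≟⌋⇒≡ {j = j} {k} h with j Fin.≟ k
... | yes j≡k = j≡k
⌊≟⌋⇒≡ () | no _

anyFin-intro : ∀ {n} (f : Fin n → Bool) z → f z ≡ true → anyFin f ≡ true
anyFin-intro f zero    fz = cong (_∨ anyFin (λ i → f (suc i))) fz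
anyFin-intro f (suc z) fz = trans (cong (f zero ∨_) (anyFin-intro (λ i → f (suc i)) z fz)) (∨-zeroʳ (f zero))

anyFin-elim : ∀ {n} (f : Fin n → Bool) → anyFin f ≡ true → ∃[ z ] f z ≡ true
anyFin-elim {zero}  f ()
anyFin-elim {suc n} f any with f zero in f0
... | true  = zero , f0
... | false with anyFin-elim (λ i → f (suc i)) any
...   | z , fz = suc z , fz

countFin-pos : ∀ {n} (f : Fin n → Bool) z → f z ≡ true → 0 ℕ.< countFin f
countFin-pos f zero    fz rewrite fz = s≤s z≤n
countFin-pos f (suc z) fz =
  ℕ.<-≤-trans (countFin-pos (λ i → f (suc i)) z fz) (ℕ.m≤n+m _ (if f zero then 1 else 0))

-- Finite sums

sumℚ≡sum : ∀ {n} (f : Fin n → ℚ) → sumℚ f ≡ sum f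
sumℚ≡sum {zero}  f = refl
sumℚ≡sum {suc n} f = cong (f zero +_) (sumℚ≡sum (λ i → f (suc i)))

sumℚ-cong : ∀ {n} {f g : Fin n → ℚ} → (∀ i → f i ≡ g i) → sumℚ f ≡ sumℚ g
sumℚ-cong {f = f} {g} f≗g = begin
  sumℚ f ≡⟨ sumℚ≡sum f ⟩
  sum f  ≡⟨ sum-cong-≗ f≗g ⟩
  sum g  ≡⟨ sumℚ≡sum g ⟨
  sumℚ g ∎

sumℚ-zero : ∀ n → sumℚ {n} (λ _ → 0ℚ) ≡ 0ℚ
sumℚ-zero n = trans (sumℚ≡sum {n} (λ _ → 0ℚ)) (sum-replicate-zero n)

sumℚ-+ : ∀ {n} (f g : Fin n → ℚ) → sumℚ (λ i → f i + g i) ≡ sumℚ f + sumℚ g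
sumℚ-+ f g = begin
  sumℚ (λ i → f i + g i) ≡⟨ sumℚ≡sum (λ i → f i + g i) ⟩
  sum (λ i → f i + g i)  ≡⟨ ∑-distrib-+ f g ⟩
  sum f + sum g          ≡⟨ cong₂ _+_ (sumℚ≡sum f) (sumℚ≡sum g) ⟨
  sumℚ f + sumℚ g        ∎

*-distribˡ-sumℚ : ∀ {n} c (f : Fin n → ℚ) → c * sumℚ f ≡ sumℚ (λ i → c * f i)
*-distribˡ-sumℚ c f = begin
  c * sumℚ f             ≡⟨ cong (c *_) (sumℚ≡sum f) ⟩
  c * sum f              ≡⟨ *-distribˡ-sum c f ⟩
  sum (λ i → c * f i)    ≡⟨ sumℚ≡sum (λ i → c * f i) ⟨
  sumℚ (λ i → c * f i)   ∎

sumℚ-comm : ∀ {m n} (f : Fin m → Fin n → ℚ) →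
            sumℚ (λ i → sumℚ (λ j → f i j)) ≡ sumℚ (λ j → sumℚ (λ i → f i j))
sumℚ-comm f = begin
  sumℚ (λ i → sumℚ (f i))          ≡⟨ sumℚ≡sum (λ i → sumℚ (f i)) ⟩
  sum (λ i → sumℚ (f i))           ≡⟨ sum-cong-≗ (λ i → sumℚ≡sum (f i)) ⟩
  sum (λ i → sum (f i))            ≡⟨ ∑-comm f ⟩
  sum (λ j → sum (λ i → f i j))    ≡⟨ sum-cong-≗ (λ j → sumℚ≡sum (λ i → f i j)) ⟨
  sum (λ j → sumℚ (λ i → f i j))   ≡⟨ sumℚ≡sum (λ j → sumℚ (λ i → f i j)) ⟨
  sumℚ (λ j → sumℚ (λ i → f i j))  ∎

sumℚ-single : ∀ {n} (f : Fin n → ℚ) j → (∀ k → k ≢ j → f k ≡ 0ℚ) → sumℚ f ≡ f j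
sumℚ-single {suc n} f zero    f≡0 = begin
  f zero + sumℚ (λ k → f (suc k))  ≡⟨ cong (f zero +_) (sumℚ-cong (λ k → f≡0 (suc k) λ ())) ⟩
  f zero + sumℚ {n} (λ _ → 0ℚ)     ≡⟨ cong (f zero +_) (sumℚ-zero n) ⟩
  f zero + 0ℚ                      ≡⟨ +-identityʳ (f zero) ⟩
  f zero                           ∎
sumℚ-single {suc n} f (suc j) f≡0 = begin
  f zero + sumℚ (λ k → f (suc k))  ≡⟨ cong (_+ sumℚ (λ k → f (suc k))) (f≡0 zero λ ()) ⟩
  0ℚ + sumℚ (λ k → f (suc k))      ≡⟨ +-identityˡ _ ⟩
  sumℚ (λ k → f (suc k))           ≡⟨ sumℚ-single (λ k → f (suc k)) j (λ k k≢j → f≡0 (suc k) (k≢j ∘ suc-injective)) ⟩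
  f (suc j)                        ∎

sumℚ-δ : ∀ {n} (j : Fin n) (f : Fin n → ℚ) → sumℚ (λ k → if ⌊ j Fin.≟ k ⌋ then f k else 0ℚ) ≡ f j
sumℚ-δ j f = begin
  sumℚ (λ k → if ⌊ j Fin.≟ k ⌋ then f k else 0ℚ)
    ≡⟨ sumℚ-single _ j (λ k k≢j → cong (λ b → if b then f k else 0ℚ) (⌊≟⌋-≢ (k≢j ∘ sym))) ⟩
  (if ⌊ j Fin.≟ j ⌋ then f j else 0ℚ)
    ≡⟨ cong (λ b → if b then f j else 0ℚ) (⌊≟⌋-refl j) ⟩
  f j ∎

sumℚ-if-countFin : ∀ {n} (p : Fin n → Bool) c → sumℚ (λ i → if p i then c else 0ℚ) ≡ ℕ→ℚ (countFin p) * c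
sumℚ-if-countFin {zero}  p c = sym (*-zeroˡ c)
sumℚ-if-countFin {suc n} p c with p zero
... | true  = begin
  c + sumℚ (λ i → if p (suc i) then c else 0ℚ)  ≡⟨ cong (c +_) (sumℚ-if-countFin (λ i → p (suc i)) c) ⟩
  c + ℕ→ℚ m * c                                 ≡⟨ solve 2 (λ c m → c :+ m :* c := (con 1ℚ :+ m) :* c) refl c (ℕ→ℚ m) ⟩
  (1ℚ + ℕ→ℚ m) * c                              ≡⟨ cong (_* c) (ℕ→ℚ-suc m) ⟨
  ℕ→ℚ (suc m) * c                               ∎
  where m = countFin (λ i → p (suc i))
... | false = trans (+-identityˡ _) (sumℚ-if-countFin (λ i → p (suc i)) c)

-- Matrices

RowSumsZero : ∀ {n} → Matrix n → Set
RowSumsZero A = ∀ i → sumℚ (A i) ≡ 0ℚ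

·-assoc : ∀ {n} (A B C : Matrix n) i j → ((A · B) · C) i j ≡ (A · (B · C)) i j
·-assoc A B C i j = begin
  sumℚ (λ k → sumℚ (λ l → A i l * B l k) * C k j)
    ≡⟨ sumℚ-cong (λ k → trans (*-comm _ (C k j)) (*-distribˡ-sumℚ (C k j) (λ l → A i l * B l k))) ⟩
  sumℚ (λ k → sumℚ (λ l → C k j * (A i l * B l k)))
    ≡⟨ sumℚ-comm (λ k l → C k j * (A i l * B l k)) ⟩
  sumℚ (λ l → sumℚ (λ k → C k j * (A i l * B l k)))
    ≡⟨ sumℚ-cong (λ l → sumℚ-cong (λ k → reorder (C k j) (A i l) (B l k))) ⟩
  sumℚ (λ l → sumℚ (λ k → A i l * (B l k * C k j)))
    ≡⟨ sumℚ-cong (λ l → sym (*-distribˡ-sumℚ (A i l) (λ k → B l k * C k j))) ⟩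
  sumℚ (λ l → A i l * sumℚ (λ k → B l k * C k j)) ∎
  where
  reorder : ∀ c a b → c * (a * b) ≡ a * (b * c)
  reorder = solve 3 (λ c a b → c :* (a :* b) := a :* (b :* c)) refl

·-congˡ : ∀ {n} {A A′ : Matrix n} (B : Matrix n) → (∀ i j → A i j ≡ A′ i j) → ∀ i j → (A · B) i j ≡ (A′ · B) i j
·-congˡ B A≡A′ i j = sumℚ-cong (λ k → cong (_* B k j) (A≡A′ i k))

·-congʳ : ∀ {n} (A : Matrix n) {B B′ : Matrix n} → (∀ i j → B i j ≡ B′ i j) → ∀ i j → (A · B) i j ≡ (A · B′) i j
·-congʳ A B≡B′ i j = sumℚ-cong (λ k → cong (A i k *_) (B≡B′ k j))

·-rowSumsZero : ∀ {n} (A : Matrix n) {B : Matrix n} → RowSumsZero B → RowSumsZero (A · B)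
·-rowSumsZero {n} A {B} B-rows i = begin
  sumℚ (λ j → sumℚ (λ k → A i k * B k j))  ≡⟨ sumℚ-comm (λ j k → A i k * B k j) ⟩
  sumℚ (λ k → sumℚ (λ j → A i k * B k j))  ≡⟨ sumℚ-cong (λ k → sym (*-distribˡ-sumℚ (A i k) (B k))) ⟩
  sumℚ (λ k → A i k * sumℚ (B k))          ≡⟨ sumℚ-cong (λ k → trans (cong (A i k *_) (B-rows k)) (*-zeroʳ (A i k))) ⟩
  sumℚ {n} (λ _ → 0ℚ)                      ≡⟨ sumℚ-zero n ⟩
  0ℚ                                       ∎

sumℚ-symmetric-form : ∀ {n} {A : Matrix n} → (∀ i j → A i j ≡ A j i) → ∀ (u v : Fin n → ℚ) →
  sumℚ (λ i → u i * sumℚ (λ j → A i j * v j)) ≡ sumℚ (λ j → v j * sumℚ (λ i → A j i * u i))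
sumℚ-symmetric-form {A = A} A-sym u v = begin
  sumℚ (λ i → u i * sumℚ (λ j → A i j * v j))    ≡⟨ sumℚ-cong (λ i → *-distribˡ-sumℚ (u i) (λ j → A i j * v j)) ⟩
  sumℚ (λ i → sumℚ (λ j → u i * (A i j * v j)))  ≡⟨ sumℚ-comm (λ i j → u i * (A i j * v j)) ⟩
  sumℚ (λ j → sumℚ (λ i → u i * (A i j * v j)))  ≡⟨ sumℚ-cong (λ j → sumℚ-cong (λ i → swap (u i) (v j) (A-sym i j))) ⟩
  sumℚ (λ j → sumℚ (λ i → v j * (A j i * u i)))  ≡⟨ sumℚ-cong (λ j → *-distribˡ-sumℚ (v j) (λ i → A j i * u i)) ⟨
  sumℚ (λ j → v j * sumℚ (λ i → A j i * u i))    ∎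
  where
  swap : ∀ a b {c d} → c ≡ d → a * (c * b) ≡ b * (d * a)
  swap a b {c} refl = solve 3 (λ a b c → a :* (c :* b) := b :* (c :* a)) refl a b c

-- The right-hand side of the equilibrium equations, read as a matrix indexed by (vertex, pole).
J-nI : ∀ {n} → Matrix n
J-nI {n} i j = 1ℚ - (if ⌊ i Fin.≟ j ⌋ then ℕ→ℚ n else 0ℚ)

J-nI-sym : ∀ {n} (i j : Fin n) → J-nI i j ≡ J-nI j i
J-nI-sym {n} i j = cong (λ b → 1ℚ - (if b then ℕ→ℚ n else 0ℚ)) (begin
  ⌊ i Fin.≟ j ⌋  ≡⟨ isYes≗does (i Fin.≟ j) ⟩
  _              ≡⟨ does-⇔ (mk⇔ sym sym) (i Fin.≟ j) (j Fin.≟ i) ⟩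
  _              ≡⟨ isYes≗does (j Fin.≟ i) ⟨
  ⌊ j Fin.≟ i ⌋  ∎)

sumℚ-J-nI* : ∀ {n} (v : Fin n → ℚ) j → sumℚ (λ k → J-nI j k * v k) ≡ sumℚ v - ℕ→ℚ n * v j
sumℚ-J-nI* {n} v j = begin
  sumℚ (λ k → J-nI j k * v k)                                           ≡⟨ sumℚ-cong (λ k → split (⌊ j Fin.≟ k ⌋) (v k)) ⟩
  sumℚ (λ k → v k + (if ⌊ j Fin.≟ k ⌋ then - (ℕ→ℚ n * v k) else 0ℚ))   ≡⟨ sumℚ-+ v _ ⟩
  sumℚ v + sumℚ (λ k → if ⌊ j Fin.≟ k ⌋ then - (ℕ→ℚ n * v k) else 0ℚ)  ≡⟨ cong (sumℚ v +_) (sumℚ-δ j (λ k → - (ℕ→ℚ n * v k))) ⟩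
  sumℚ v - ℕ→ℚ n * v j                                                  ∎
  where
  split : ∀ b w → (1ℚ - (if b then ℕ→ℚ n else 0ℚ)) * w ≡ w + (if b then - (ℕ→ℚ n * w) else 0ℚ)
  split true  = solve 2 (λ m w → (con 1ℚ :- m) :* w := w :+ :- (m :* w)) refl (ℕ→ℚ n)
  split false = solve 1 (λ w → (con 1ℚ :- con 0ℚ) :* w := w :+ con 0ℚ) refl

sumℚ-*J-nI : ∀ {n} (v : Fin n → ℚ) j → sumℚ (λ k → v k * J-nI k j) ≡ sumℚ v - ℕ→ℚ n * v j
sumℚ-*J-nI v j = trans (sumℚ-cong (λ k → trans (*-comm (v k) _) (cong (_* v k) (J-nI-sym k j)))) (sumℚ-J-nI* v j)

·J-nI : ∀ {n} {A : Matrix n} → RowSumsZero A → ∀ i j → (A · J-nI) i j ≡ - (ℕ→ℚ n * A i j)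
·J-nI {n} {A} A-rows i j = begin
  sumℚ (λ k → A i k * J-nI k j)  ≡⟨ sumℚ-*J-nI (A i) j ⟩
  sumℚ (A i) - ℕ→ℚ n * A i j     ≡⟨ cong (_- ℕ→ℚ n * A i j) (A-rows i) ⟩
  0ℚ - ℕ→ℚ n * A i j             ≡⟨ solve 1 (λ x → con 0ℚ :- x := :- x) refl (ℕ→ℚ n * A i j) ⟩
  - (ℕ→ℚ n * A i j)              ∎

-- From (G A)(A B) = A B = J − nI and zero row sums, G A = I − J/n; then −n G = G (A B) = (G A) B.
groupInverse-formula : ∀ {n} .{{_ : NonZero n}} {A G B : Matrix n} →
  RowSumsZero A → IsGroupInverse A G → (∀ i j → (A · B) i j ≡ J-nI i j) →
  ∀ i j → G i j ≡ recipℕ n * (recipℕ n * (J-nI · B) i j)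
groupInverse-formula {n} {A} {G} {B} A-rows (AGA≡A , GAG≡G , AG≡GA) AB≡J-nI i j =
  ℕ→ℚ*a≡b⇒a≡recipℕ*b n (begin
    ℕ→ℚ n * G i j
      ≡⟨ neg-involutive _ ⟨
    - - (ℕ→ℚ n * G i j)
      ≡⟨ cong -_ (·J-nI G-rows i j) ⟨
    - (G · J-nI) i j
      ≡⟨ cong -_ (G·J-nI≡GA·B i j) ⟩
    - ((G · A) · B) i j
      ≡⟨ cong -_ (sumℚ-cong (λ k → cong (_* B k j) (GA≡ i k))) ⟩
    - sumℚ (λ k → (recipℕ n * - J-nI i k) * B k j)
      ≡⟨ cong -_ (sumℚ-cong (λ k → reorder (recipℕ n) (J-nI i k) (B k j))) ⟩
    - sumℚ (λ k → - recipℕ n * (J-nI i k * B k j))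
      ≡⟨ cong -_ (*-distribˡ-sumℚ (- recipℕ n) (λ k → J-nI i k * B k j)) ⟨
    - (- recipℕ n * (J-nI · B) i j)
      ≡⟨ solve 2 (λ r x → :- (:- r :* x) := r :* x) refl (recipℕ n) ((J-nI · B) i j) ⟩
    recipℕ n * (J-nI · B) i j ∎)
  where
  reorder : ∀ r e b → (r * - e) * b ≡ - r * (e * b)
  reorder = solve 3 (λ r e b → (r :* :- e) :* b := :- r :* (e :* b)) refl

  G≡GG·A : ∀ i j → G i j ≡ ((G · G) · A) i j
  G≡GG·A i j = begin
    G i j              ≡⟨ GAG≡G i j ⟨
    ((G · A) · G) i j  ≡⟨ ·-assoc G A G i j ⟩
    (G · (A · G)) i j  ≡⟨ ·-congʳ G AG≡GA i j ⟩
    (G · (G · A)) i j  ≡⟨ ·-assoc G G A i j ⟨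
    ((G · G) · A) i j  ∎

  G-rows : RowSumsZero G
  G-rows i = trans (sumℚ-cong (G≡GG·A i)) (·-rowSumsZero (G · G) A-rows i)

  G·J-nI≡GA·B : ∀ i j → (G · J-nI) i j ≡ ((G · A) · B) i j
  G·J-nI≡GA·B i j = trans (·-congʳ G (λ k l → sym (AB≡J-nI k l)) i j) (sym (·-assoc G A B i j))

  GA·A≡A : ∀ i j → ((G · A) · A) i j ≡ A i j
  GA·A≡A i j = trans (·-congˡ A (λ k l → sym (AG≡GA k l)) i j) (AGA≡A i j)

  GA≡ : ∀ i j → (G · A) i j ≡ recipℕ n * - J-nI i j
  GA≡ i j = ℕ→ℚ*a≡b⇒a≡recipℕ*b n (begin
    ℕ→ℚ n * (G · A) i j        ≡⟨ neg-involutive _ ⟨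
    - - (ℕ→ℚ n * (G · A) i j)  ≡⟨ cong -_ (·J-nI (·-rowSumsZero G A-rows) i j) ⟨
    - ((G · A) · J-nI) i j     ≡⟨ cong -_ (·-congʳ (G · A) (λ k l → sym (AB≡J-nI k l)) i j) ⟩
    - ((G · A) · (A · B)) i j  ≡⟨ cong -_ (·-assoc (G · A) A B i j) ⟨
    - (((G · A) · A) · B) i j  ≡⟨ cong -_ (·-congˡ B GA·A≡A i j) ⟩
    - (A · B) i j              ≡⟨ cong -_ (AB≡J-nI i j) ⟩
    - J-nI i j                 ∎)

-- Laplacian, equilibrium functions and distance

module _ {n} (Γ : Graph n) where
  open Graph Γ

  Lmat-sym : ∀ x y → Lmat Γ x y ≡ Lmat Γ y x
  Lmat-sym x y with x Fin.≟ y
  ... | yes refl rewrite ⌊≟⌋-refl x = refl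
  ... | no x≢y rewrite ⌊≟⌋-≢ (x≢y ∘ sym) | adj-sym x y = refl

  Lmat*-split : ∀ x y (u : Fin n → ℚ) → Lmat Γ x y * u y
    ≡ (if ⌊ x Fin.≟ y ⌋ then ℕ→ℚ (degree Γ x) * u y else 0ℚ) + (if adj x y then - u y else 0ℚ)
  Lmat*-split x y u with x Fin.≟ y
  ... | yes refl rewrite irrefl x = sym (+-identityʳ _)
  ... | no _ with adj x y
  ...   | true  = solve 1 (λ v → :- con 1ℚ :* v := con 0ℚ :+ :- v) refl (u y)
  ...   | false = solve 1 (λ v → con 0ℚ :* v := con 0ℚ :+ con 0ℚ) refl (u y)

  Lmat*-sumℚ≡lap : ∀ (u : Fin n → ℚ) x → sumℚ (λ y → Lmat Γ x y * u y) ≡ lap Γ u x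
  Lmat*-sumℚ≡lap u x = begin
    sumℚ (λ y → Lmat Γ x y * u y)                            ≡⟨ sumℚ-cong (λ y → Lmat*-split x y u) ⟩
    sumℚ (λ y → diag y + offDiag y)                          ≡⟨ sumℚ-+ diag offDiag ⟩
    sumℚ diag + sumℚ offDiag                                 ≡⟨ cong (_+ sumℚ offDiag) (sumℚ-δ x (λ y → ℕ→ℚ (degree Γ x) * u y)) ⟩
    ℕ→ℚ (degree Γ x) * u x + sumℚ offDiag                    ≡⟨ cong (_+ sumℚ offDiag) (sumℚ-if-countFin (adj x) (u x)) ⟨
    sumℚ (λ y → if adj x y then u x else 0ℚ) + sumℚ offDiag  ≡⟨ sumℚ-+ (λ y → if adj x y then u x else 0ℚ) offDiag ⟨
    sumℚ (λ y → (if adj x y then u x else 0ℚ) + offDiag y)   ≡⟨ sumℚ-cong (λ y → merge (adj x y) (u x) (u y)) ⟩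
    lap Γ u x                                                ∎
    where
    diag offDiag : Fin n → ℚ
    diag y = if ⌊ x Fin.≟ y ⌋ then ℕ→ℚ (degree Γ x) * u y else 0ℚ
    offDiag y = if adj x y then - u y else 0ℚ
    merge : ∀ b a c → (if b then a else 0ℚ) + (if b then - c else 0ℚ) ≡ (if b then a - c else 0ℚ)
    merge true  a c = refl
    merge false a c = +-identityˡ 0ℚ

  Lmat-rowSumsZero : RowSumsZero (Lmat Γ)
  Lmat-rowSumsZero x = begin
    sumℚ (Lmat Γ x)               ≡⟨ sumℚ-cong (λ y → sym (*-identityʳ (Lmat Γ x y))) ⟩
    sumℚ (λ y → Lmat Γ x y * 1ℚ)  ≡⟨ Lmat*-sumℚ≡lap (λ _ → 1ℚ) x ⟩
    lap Γ (λ _ → 1ℚ) x            ≡⟨ sumℚ-cong (λ y → vanish (adj x y)) ⟩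
    sumℚ {n} (λ _ → 0ℚ)           ≡⟨ sumℚ-zero n ⟩
    0ℚ                            ∎
    where
    vanish : ∀ b → (if b then 1ℚ - 1ℚ else 0ℚ) ≡ 0ℚ
    vanish true  = refl
    vanish false = refl

  module _ {ν : Fin n → Fin n → ℚ} (ν-eq : ∀ y → IsEquilibrium Γ (ν y) y) where

    Lmat·equilibrium : ∀ i j → (Lmat Γ · (λ k j → ν j k)) i j ≡ J-nI i j
    Lmat·equilibrium i j = trans (Lmat*-sumℚ≡lap (ν j) i) (proj₂ (proj₂ (ν-eq j)) i)

    equilibrium-reciprocity : ∀ x y → sumℚ (ν x) - ℕ→ℚ n * ν x y ≡ sumℚ (ν y) - ℕ→ℚ n * ν y x
    equilibrium-reciprocity x y = begin
      sumℚ (ν x) - ℕ→ℚ n * ν x y                            ≡⟨ sumℚ-*J-nI (ν x) y ⟨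
      sumℚ (λ k → ν x k * J-nI k y)                         ≡⟨ sumℚ-cong (λ k → cong (ν x k *_) (Lmat·equilibrium k y)) ⟨
      sumℚ (λ k → ν x k * sumℚ (λ l → Lmat Γ k l * ν y l))  ≡⟨ sumℚ-symmetric-form Lmat-sym (ν x) (ν y) ⟩
      sumℚ (λ l → ν y l * sumℚ (λ k → Lmat Γ l k * ν x k))  ≡⟨ sumℚ-cong (λ l → cong (ν y l *_) (Lmat·equilibrium l x)) ⟩
      sumℚ (λ l → ν y l * J-nI l x)                         ≡⟨ sumℚ-*J-nI (ν y) x ⟩
      sumℚ (ν y) - ℕ→ℚ n * ν y x                            ∎

  equilibrium-neighbours : ∀ {u x c} → IsEquilibrium Γ u x → (∀ z → adj x z ≡ true → u z ≡ c) →
    ℕ→ℚ (degree Γ x) * c ≡ ℕ→ℚ n - 1ℚ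
  equilibrium-neighbours {u} {x} {c} (ux≡0 , _ , lap-u) u≡c = begin
    ℕ→ℚ (degree Γ x) * c                           ≡⟨ solve 2 (λ d c → d :* c := :- (d :* :- c)) refl (ℕ→ℚ (degree Γ x)) c ⟩
    - (ℕ→ℚ (degree Γ x) * - c)                     ≡⟨ cong -_ (sumℚ-if-countFin (adj x) (- c)) ⟨
    - sumℚ (λ z → if adj x z then - c else 0ℚ)     ≡⟨ cong -_ (sumℚ-cong edge) ⟨
    - lap Γ u x                                    ≡⟨ cong -_ (lap-u x) ⟩
    - (1ℚ - (if ⌊ x Fin.≟ x ⌋ then ℕ→ℚ n else 0ℚ))  ≡⟨ cong (λ b → - (1ℚ - (if b then ℕ→ℚ n else 0ℚ))) (⌊≟⌋-refl x) ⟩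
    - (1ℚ - ℕ→ℚ n)                                 ≡⟨ solve 1 (λ m → :- (con 1ℚ :- m) := m :- con 1ℚ) refl (ℕ→ℚ n) ⟩
    ℕ→ℚ n - 1ℚ                                     ∎
    where
    edge : ∀ z → (if adj x z then u x - u z else 0ℚ) ≡ (if adj x z then - c else 0ℚ)
    edge z with adj x z in xz
    ... | true  = trans (cong₂ _-_ ux≡0 (u≡c z xz)) (+-identityˡ (- c))
    ... | false = refl

  reach-suc⁺ : ∀ k {x y} → reach Γ k x y ≡ true → reach Γ (suc k) x y ≡ true
  reach-suc⁺ k {x} {y} xy = cong (_∨ anyFin (λ z → adj x z ∧ reach Γ k z y)) xy

  reach-step : ∀ k {x z y} → adj x z ≡ true → reach Γ k z y ≡ true → reach Γ (suc k) x y ≡ true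
  reach-step k {x} {z} {y} xz zy = trans (cong (reach Γ k x y ∨_) step) (∨-zeroʳ (reach Γ k x y))
    where
    step : anyFin (λ w → adj x w ∧ reach Γ k w y) ≡ true
    step = anyFin-intro _ z (cong₂ _∧_ xz zy)

  reach-suc⁻ : ∀ k {x y} → reach Γ (suc k) x y ≡ true →
    reach Γ k x y ≡ true ⊎ ∃[ z ] adj x z ≡ true × reach Γ k z y ≡ true
  reach-suc⁻ k {x} {y} xy with reach Γ k x y
  ... | true  = inj₁ refl
  ... | false with anyFin-elim (λ z → adj x z ∧ reach Γ k z y) xy
  ...   | z , p with adj x z in xz
  ...     | true  = inj₂ (z , xz , p)
  ...     | false = contradiction p λ ()

  reach-snoc : ∀ k {x z y} → reach Γ k x z ≡ true → adj z y ≡ true → reach Γ (suc k) x y ≡ true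
  reach-snoc zero    {y = y} xz zy with ⌊≟⌋⇒≡ xz
  ... | refl = reach-step 0 zy (⌊≟⌋-refl y)
  reach-snoc (suc k) xz zy with reach-suc⁻ k xz
  ... | inj₁ xz′           = reach-suc⁺ (suc k) (reach-snoc k xz′ zy)
  ... | inj₂ (w , xw , wz) = reach-step (suc k) xw (reach-snoc k wz zy)

  reach-reverse : ∀ k {x y} → reach Γ k x y ≡ true → reach Γ k y x ≡ true
  reach-reverse zero    {x} xy with ⌊≟⌋⇒≡ xy
  ... | refl = ⌊≟⌋-refl x
  reach-reverse (suc k) xy with reach-suc⁻ k xy
  ... | inj₁ xy′           = reach-suc⁺ k (reach-reverse k xy′)
  ... | inj₂ (w , xw , wy) = reach-snoc k (reach-reverse k wy) (trans (adj-sym _ _) xw)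

  reach-sym : ∀ k x y → reach Γ k x y ≡ reach Γ k y x
  reach-sym k x y = ⇔→≡ (mk⇔ (reach-reverse k) (reach-reverse k))

  distSearch-sym : ∀ x y f k → distSearch Γ x y f k ≡ distSearch Γ y x f k
  distSearch-sym x y zero    k = refl
  distSearch-sym x y (suc f) k = cong₂ (λ b d → if b then k else d) (reach-sym k x y) (distSearch-sym x y f (suc k))

  dist-sym : ∀ x y → dist Γ x y ≡ dist Γ y x
  dist-sym x y = distSearch-sym x y n 0

  distSearch-found : ∀ {x y} f k → reach Γ k x y ≡ true → distSearch Γ x y f k ≡ k
  distSearch-found zero    k xy = refl
  distSearch-found (suc f) k xy rewrite xy = refl

  reach-invariant : ∀ {A : Set} (h : Fin n → A) → (∀ {x y} → adj x y ≡ true → h x ≡ h y) →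
    ∀ k {x y} → reach Γ k x y ≡ true → h x ≡ h y
  reach-invariant h h-edge zero    xy = cong h (⌊≟⌋⇒≡ xy)
  reach-invariant h h-edge (suc k) xy with reach-suc⁻ k xy
  ... | inj₁ xy′           = reach-invariant h h-edge k xy′
  ... | inj₂ (w , xw , wy) = trans (h-edge xw) (reach-invariant h h-edge k wy)

  connected⇒edge-invariant-constant : Connected Γ → ∀ {A : Set} (h : Fin n → A) →
    (∀ {x y} → adj x y ≡ true → h x ≡ h y) → ∀ x y → h x ≡ h y
  connected⇒edge-invariant-constant connected h h-edge x y =
    reach-invariant h h-edge (proj₁ (connected x y)) (proj₂ (connected x y))

adj⇒dist≡1 : ∀ {n} (Γ : Graph n) {x y} → Graph.adj Γ x y ≡ true → dist Γ x y ≡ 1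
adj⇒dist≡1 {zero}  Γ {()}
adj⇒dist≡1 {suc n} Γ {x} {y} xy = begin
  (if ⌊ x Fin.≟ y ⌋ then 0 else distSearch Γ x y n 1)  ≡⟨ cong (λ b → if b then 0 else distSearch Γ x y n 1) (⌊≟⌋-≢ x≢y) ⟩
  distSearch Γ x y n 1                                  ≡⟨ distSearch-found Γ n 1 (reach-step Γ 0 xy (⌊≟⌋-refl y)) ⟩
  1                                                     ∎
  where
  x≢y : x ≢ y
  x≢y refl = contradiction (trans (sym (Graph.irrefl Γ x)) xy) λ ()

radial⇒neighbourhood-constant : ∀ {n} (Γ : Graph n) {ν : Fin n → Fin n → ℚ} (f : Fin n → ℕ → ℚ) →
  (∀ x y → ν x y ≡ f x (dist Γ x y)) →
  ∀ {x y z} → Graph.adj Γ x y ≡ true → Graph.adj Γ x z ≡ true → ν x y ≡ ν x z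
radial⇒neighbourhood-constant Γ {ν = ν} f ν≡f {x} {y} {z} xy xz = begin
  ν x y            ≡⟨ ν≡f x y ⟩
  f x (dist Γ x y) ≡⟨ cong (f x) (trans (adj⇒dist≡1 Γ xy) (sym (adj⇒dist≡1 Γ xz))) ⟩
  f x (dist Γ x z) ≡⟨ ν≡f x z ⟨
  ν x z            ∎

-- Effective resistance

effRes-equilibrium : ∀ {n} .{{_ : NonZero n}} (Γ : Graph n) {ν : Fin n → Fin n → ℚ} →
  (∀ y → IsEquilibrium Γ (ν y) y) → ∀ {Ls} → IsGroupInverse (Lmat Γ) Ls → ∀ x y →
  effRes Γ Ls x y ≡ (ℕ→ℚ 2 * recipℕ n) * ν y x + recipℕ n * (recipℕ n * (sumℚ (ν x) - sumℚ (ν y)))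
effRes-equilibrium {n} Γ {ν} ν-eq {Ls} Ls-inv x y = begin
  Ls x x + Ls y y - ℕ→ℚ 2 * Ls x y
    ≡⟨ cong₂ _-_ (cong₂ _+_ (Ls-diag x) (Ls-diag y)) (cong (ℕ→ℚ 2 *_) (Ls≡ x y)) ⟩
  r * (r * sumℚ (ν x)) + r * (r * sumℚ (ν y)) - ℕ→ℚ 2 * (r * (r * (sumℚ (ν y) - m * ν y x)))
    -- ℕ→ℚ 2 reduces to 1ℚ + 1ℚ, which the solver needs as a constant
    ≡⟨ solve 5 (λ r m sx sy v → r :* (r :* sx) :+ r :* (r :* sy) :- (con 1ℚ :+ con 1ℚ) :* (r :* (r :* (sy :- m :* v)))
                                 := ((con 1ℚ :+ con 1ℚ) :* r) :* (r :* (m :* v)) :+ r :* (r :* (sx :- sy)))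
             refl r m (sumℚ (ν x)) (sumℚ (ν y)) (ν y x) ⟩
  (ℕ→ℚ 2 * r) * (r * (m * ν y x)) + r * (r * (sumℚ (ν x) - sumℚ (ν y)))
    ≡⟨ cong (λ v → (ℕ→ℚ 2 * r) * v + r * (r * (sumℚ (ν x) - sumℚ (ν y)))) (recipℕ*ℕ→ℚ*-cancel n (ν y x)) ⟩
  (ℕ→ℚ 2 * r) * ν y x + r * (r * (sumℚ (ν x) - sumℚ (ν y))) ∎
  where
  r m : ℚ
  r = recipℕ n
  m = ℕ→ℚ n
  Ls≡ : ∀ i j → Ls i j ≡ r * (r * (sumℚ (ν j) - m * ν j i))
  Ls≡ i j = trans (groupInverse-formula (Lmat-rowSumsZero Γ) Ls-inv (Lmat·equilibrium Γ ν-eq) i j)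
                  (cong (λ a → r * (r * a)) (sumℚ-J-nI* (ν j) i))
  Ls-diag : ∀ i → Ls i i ≡ r * (r * sumℚ (ν i))
  Ls-diag i = begin
    Ls i i
      ≡⟨ Ls≡ i i ⟩
    r * (r * (sumℚ (ν i) - m * ν i i))
      ≡⟨ cong (λ a → r * (r * (sumℚ (ν i) - m * a))) (proj₁ (ν-eq i)) ⟩
    r * (r * (sumℚ (ν i) - m * 0ℚ))
      ≡⟨ cong (λ s → r * (r * s)) (solve 2 (λ s m → s :- m :* con 0ℚ := s) refl (sumℚ (ν i)) m) ⟩
    r * (r * sumℚ (ν i)) ∎

module _ {n} (Γ : Graph n) {ν : Fin n → Fin n → ℚ} (ν-eq : ∀ y → IsEquilibrium Γ (ν y) y)
  (ν-neighbours : ∀ {x y z} → Graph.adj Γ x y ≡ true → Graph.adj Γ x z ≡ true → ν x y ≡ ν x z) where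
  open Graph Γ

  equilibrium-at-neighbour : ∀ {x y} → adj x y ≡ true → ν x y ≡ recipℕ (degree Γ x) * (ℕ→ℚ n - 1ℚ)
  equilibrium-at-neighbour {x} {y} xy =
    ℕ→ℚ*a≡b⇒a≡recipℕ*b (degree Γ x) {{ℕ.>-nonZero (countFin-pos (adj x) y xy)}}
      (equilibrium-neighbours Γ (ν-eq x) (λ z xz → ν-neighbours xz xy))

  sumℚ-equilibrium-difference : Connected Γ → ∀ x y →
    sumℚ (ν x) - sumℚ (ν y) ≡ ℕ→ℚ n * ((ℕ→ℚ n - 1ℚ) * (recipℕ (degree Γ x) - recipℕ (degree Γ y)))
  sumℚ-equilibrium-difference connected x y = begin
    sumℚ (ν x) - sumℚ (ν y)
      ≡⟨ solve 6 (λ m c sx sy a b → sx :- sy := ((sx :- m :* (a :* c)) :- (sy :- m :* (b :* c))) :+ m :* (c :* (a :- b)))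
               refl m c (sumℚ (ν x)) (sumℚ (ν y)) (d x) (d y) ⟩
    (h x - h y) + m * (c * (d x - d y))
      ≡⟨ cong (λ t → (t - h y) + m * (c * (d x - d y))) (connected⇒edge-invariant-constant Γ connected h h-edge x y) ⟩
    (h y - h y) + m * (c * (d x - d y))
      ≡⟨ solve 2 (λ H X → (H :- H) :+ X := X) refl (h y) (m * (c * (d x - d y))) ⟩
    m * (c * (d x - d y)) ∎
    where
    m c : ℚ
    m = ℕ→ℚ n
    c = ℕ→ℚ n - 1ℚ
    d h : Fin n → ℚ
    d z = recipℕ (degree Γ z)
    h z = sumℚ (ν z) - m * (d z * c)

    h-edge : ∀ {x y} → adj x y ≡ true → h x ≡ h y
    h-edge {x} {y} xy = begin
      h x                         ≡⟨ cong (λ v → sumℚ (ν x) - m * v) (equilibrium-at-neighbour xy) ⟨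
      sumℚ (ν x) - m * ν x y      ≡⟨ equilibrium-reciprocity Γ ν-eq x y ⟩
      sumℚ (ν y) - m * ν y x      ≡⟨ cong (λ v → sumℚ (ν y) - m * v) (equilibrium-at-neighbour (trans (adj-sym y x) xy)) ⟩
      h y                         ∎

  effRes-neighbourhood-constant : .{{_ : NonZero n}} → Connected Γ → ∀ {Ls} → IsGroupInverse (Lmat Γ) Ls → ∀ x y →
    effRes Γ Ls x y ≡ (ℕ→ℚ 2 * recipℕ n) * ν y x + (ℕ→ℚ (n ∸ 1) * recipℕ n) * (recipℕ (degree Γ x) - recipℕ (degree Γ y))
  effRes-neighbourhood-constant connected {Ls} Ls-inv x y = begin
    effRes Γ Ls x y
      ≡⟨ effRes-equilibrium Γ ν-eq Ls-inv x y ⟩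
    (ℕ→ℚ 2 * r) * ν y x + r * (r * (sumℚ (ν x) - sumℚ (ν y)))
      ≡⟨ cong (λ s → (ℕ→ℚ 2 * r) * ν y x + r * (r * s)) (sumℚ-equilibrium-difference connected x y) ⟩
    (ℕ→ℚ 2 * r) * ν y x + r * (r * (ℕ→ℚ n * ((ℕ→ℚ n - 1ℚ) * δ)))
      ≡⟨ cong (λ t → (ℕ→ℚ 2 * r) * ν y x + r * t) (recipℕ*ℕ→ℚ*-cancel n _) ⟩
    (ℕ→ℚ 2 * r) * ν y x + r * ((ℕ→ℚ n - 1ℚ) * δ)
      ≡⟨ cong (λ c → (ℕ→ℚ 2 * r) * ν y x + r * (c * δ)) (ℕ→ℚ-∸1 n) ⟩
    (ℕ→ℚ 2 * r) * ν y x + r * (ℕ→ℚ (n ∸ 1) * δ)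
      ≡⟨ cong ((ℕ→ℚ 2 * r) * ν y x +_) (solve 3 (λ r c δ → r :* (c :* δ) := (c :* r) :* δ) refl r (ℕ→ℚ (n ∸ 1)) δ) ⟩
    (ℕ→ℚ 2 * r) * ν y x + (ℕ→ℚ (n ∸ 1) * r) * δ ∎
    where
    r δ : ℚ
    r = recipℕ n
    δ = recipℕ (degree Γ x) - recipℕ (degree Γ y)

corollary3p7 : ∀ {n : ℕ} (Γ : Graph n) → 2 ≤ n → Connected Γ
    → (DB : DistanceBiregular Γ)
    → (ν : Fin n → Fin n → ℚ) → (∀ y → IsEquilibrium Γ (ν y) y)
    → (q : Fin 2 → ℕ → ℚ)
    → (∀ x y → ν x y ≡ q (DistanceBiregular.side DB x) (dist Γ x y))
    → (Ls : Matrix n) → IsGroupInverse (Lmat Γ) Ls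
    → ∀ (x y : Fin n)
    → effRes Γ Ls x y
      ≡ (ℕ→ℚ 2 * recipℕ n) * q (DistanceBiregular.side DB y) (dist Γ x y)
        + (ℕ→ℚ (n ∸ 1) * recipℕ n)
          * (recipℕ (DistanceBiregular.k DB (DistanceBiregular.side DB x))
             - recipℕ (DistanceBiregular.k DB (DistanceBiregular.side DB y)))
corollary3p7 {n} Γ 2≤n connected DB ν ν-eq q ν≡q Ls Ls-inv x y = begin
  effRes Γ Ls x y
    ≡⟨ effRes-neighbourhood-constant Γ ν-eq ν-neighbours connected Ls-inv x y ⟩
  (ℕ→ℚ 2 * recipℕ n) * ν y x + (ℕ→ℚ (n ∸ 1) * recipℕ n) * (recipℕ (degree Γ x) - recipℕ (degree Γ y))
    ≡⟨ cong₂ (λ v δ → (ℕ→ℚ 2 * recipℕ n) * v + (ℕ→ℚ (n ∸ 1) * recipℕ n) * δ)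
             (trans (ν≡q y x) (cong (q (side y)) (dist-sym Γ y x)))
             (cong₂ (λ a b → recipℕ a - recipℕ b) (deg-k x) (deg-k y)) ⟩
  (ℕ→ℚ 2 * recipℕ n) * q (side y) (dist Γ x y) + (ℕ→ℚ (n ∸ 1) * recipℕ n) * (recipℕ (k (side x)) - recipℕ (k (side y))) ∎
  where
  open DistanceBiregular DB
  instance
    _ : NonZero n
    _ = ℕ.>-nonZero (ℕ.≤-trans (s≤s z≤n) 2≤n)
  ν-neighbours : ∀ {x y z} → Graph.adj Γ x y ≡ true → Graph.adj Γ x z ≡ true → ν x y ≡ ν x z
  ν-neighbours = radial⇒neighbourhood-constant Γ (q ∘ side) ν≡q
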